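{- For integers $0\le j\le m$, \[ (m+1)\sum_{k=j}^m\frac{s(m,k)}{k+1}(-1)^{k-j}\binom{k+1}{k-j}B_{k-j}=s_1(m,j),\qquad\text{where } s_1(m,j)=s(m,j+1)+s(m,j). \]
   Context: $s(m,k)$ are the signed Stirling numbers of the first kind, defined by $x(x-1)\cdots(x-m+1)=\sum_{k=0}^m s(m,k)x^k$ (with $s(m,k)=0$ for $k>m$). Bernoulli numbers: $B_0=1$, $B_k=-\frac1{k+1}\sum_{i=0}^{k-1}\binom{k+1}{i}B_i$ for $k\ge1$ (so $B_1=-1/2$). -}

module Defs where

open import Data.Nat using (ℕ; zero; suc; _+_; _∸_)
open import Data.Nat.Combinatorics using (_C_)
open import Data.Integer using (ℤ; +_)
import Data.Integer as ℤ
open import Data.Rational using (ℚ; _/_; 0ℚ; 1ℚ)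
import Data.Rational as ℚ
open import Data.List using (List; []; _∷_; _++_; [_]; lookup; length; upTo; map; foldr; reverse)
open import Data.Fin using (Fin)

-- Signed Stirling numbers of the first kind:
--   x(x-1)...(x-m+1) = Σ_k s(m,k) x^k,
-- equivalently s(0,0)=1, s(0,k+1)=0, s(m+1,0)=0,
-- s(m+1,k+1) = s(m,k) - m * s(m,k+1).
stirling1 : ℕ → ℕ → ℤ
stirling1 zero zero = + 1
stirling1 zero (suc k) = + 0
stirling1 (suc m) zero = + 0
stirling1 (suc m) (suc k) = stirling1 m k ℤ.- (+ m) ℤ.* stirling1 m (suc k)

sumℚ : ℕ → (ℕ → ℚ) → ℚ
sumℚ zero f = 0ℚ
sumℚ (suc n) f = sumℚ n f ℚ.+ f n

-- B_k = -1/(k+1) * Σ_{i<k} C(k+1,i) B_i, computed via the list [B_0, ..., B_{n-1}]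
-- (lookup with default 0 outside the computed range, never used)
nth : List ℚ → ℕ → ℚ
nth [] _ = 0ℚ
nth (x ∷ xs) zero = x
nth (x ∷ xs) (suc i) = nth xs i

bernoulliList : ℕ → List ℚ
bernoulliList zero = []
bernoulliList (suc zero) = 1ℚ ∷ []
bernoulliList (suc (suc k)) =
  let bs = bernoulliList (suc k)
      kk = suc k
  in bs ++ [ ℚ.- ((+ 1 / suc kk) ℚ.* sumℚ kk (λ i → ((+ (suc kk C i)) / 1) ℚ.* nth bs i)) ]

bernoulli : ℕ → ℚ
bernoulli k = nth (bernoulliList (suc k)) k

signℚ : ℕ → ℚ
signℚ zero = 1ℚ
signℚ (suc n) = ℚ.- signℚ n

stirling1' : ℕ → ℕ → ℤ
stirling1' m j = stirling1 m (suc j) ℤ.+ stirling1 m j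

term : ℕ → ℕ → ℕ → ℚ
term m j d = let k = j + d in
  ((stirling1 m k) / suc k) ℚ.* signℚ d ℚ.* ((+ (suc k C d)) / 1) ℚ.* bernoulli d

-- Read polynomials as coefficient sequences ℕ → ℚ and let ∇p(x) = p(x) − p(x − 1). The Bernoulli
-- polynomials give, for every k, a polynomial Pₖ(x) = (−1)ᵏ⁺¹ Bₖ₊₁(−x) / (k + 1) with ∇Pₖ = xᵏ.
-- Its coefficients are the summands of the left-hand side, which is therefore the coefficient of
-- x^(j+1) in (m + 1)·Q, where Q = Σₖ s(m, k) Pₖ satisfies ∇Q = x(x − 1)⋯(x − m + 1).
-- The polynomial (1 + x)·x(x − 1)⋯(x − m + 1), whose coefficient of x^(j+1) is s(m, j + 1) + s(m, j),
-- also has backward difference (m + 1)·x(x − 1)⋯(x − m + 1), since x(x − 1)⋯(x − m) is both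
-- x·[(x − 1)⋯(x − m)] and (x − m)·[x(x − 1)⋯(x − m + 1)]. A polynomial with vanishing backward
-- difference is constant, so (m + 1)·Q and (1 + x)·x(x − 1)⋯(x − m + 1) agree above degree 0.

module Submission where

open import Defs
open import Data.Nat as ℕ using (ℕ; zero; suc; _≤_; _<_; _∸_; z≤n; s≤s; _!)
import Data.Nat.Properties as ℕP
open import Data.Nat.Combinatorics
  using (_C_; nCn≡1; nC1≡n; nCk≡nC[n∸k]; k>n⇒nCk≡0; nCk+nC[k+1]≡[n+1]C[k+1]; nCk≡n!/k![n-k]!; k![n∸k]!∣n!)
open import Data.Nat.DivMod using (m/n*n≡m)
open import Data.Nat.Tactic.RingSolver using (solve-∀)
open import Data.Integer as ℤ using (ℤ; +_)
import Data.Integer.Properties as ℤP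
open import Data.Rational as ℚ using (ℚ; _/_; 0ℚ; 1ℚ; _+_; _*_; -_; _-_; toℚᵘ)
import Data.Rational.Properties as ℚP
import Data.Rational.Unnormalised as ℚᵘ
import Data.Rational.Unnormalised.Properties as ℚᵘP
open import Data.Rational.Solver using (module +-*-Solver)
open import Algebra.Properties.Group ℚP.+-0-group using (x∙y⁻¹≈ε⇒x≈y; ⁻¹-involutive)
open import Data.List using (List; []; _∷_; _++_; [_]; length)
import Data.List.Properties as ListP
open import Data.Product using (_,_)
open import Relation.Nullary using (yes; no)
open import Data.Empty using (⊥-elim)
open import Function using (_∘_)
open import Relation.Binary.PropositionalEquality hiding ([_])

open +-*-Solver

ι : ℤ → ℚ
ι z = z / 1

1/[1+_] : ℕ → ℚ
1/[1+ n ] = + 1 / suc n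

private
  toℚᵘ-ι : ∀ z → toℚᵘ (ι z) ℚᵘ.≃ ℚᵘ.mkℚᵘ z 0
  toℚᵘ-ι z = ℚP.toℚᵘ-fromℚᵘ (ℚᵘ.mkℚᵘ z 0)
  toℚᵘ-1/[1+] : ∀ n → toℚᵘ 1/[1+ n ] ℚᵘ.≃ ℚᵘ.mkℚᵘ (+ 1) n
  toℚᵘ-1/[1+] n = ℚP.toℚᵘ-fromℚᵘ (ℚᵘ.mkℚᵘ (+ 1) n)
  viaℚᵘ : ∀ {p q u v} → toℚᵘ p ℚᵘ.≃ u → toℚᵘ q ℚᵘ.≃ v → u ℚᵘ.≃ v → p ≡ q
  viaℚᵘ p≃u q≃v u≃v = ℚP.toℚᵘ-injective (ℚᵘP.≃-trans p≃u (ℚᵘP.≃-trans u≃v (ℚᵘP.≃-sym q≃v)))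

ι-+ : ∀ a b → ι (a ℤ.+ b) ≡ ι a + ι b
ι-+ a b = viaℚᵘ (toℚᵘ-ι (a ℤ.+ b))
  (ℚᵘP.≃-trans (ℚP.toℚᵘ-homo-+ (ι a) (ι b)) (ℚᵘP.+-cong (toℚᵘ-ι a) (toℚᵘ-ι b)))
  (ℚᵘ.*≡* (cong₂ ℤ._*_ (sym (cong₂ ℤ._+_ (ℤP.*-identityʳ a) (ℤP.*-identityʳ b))) refl))

ι-* : ∀ a b → ι (a ℤ.* b) ≡ ι a * ι b
ι-* a b = viaℚᵘ (toℚᵘ-ι (a ℤ.* b))
  (ℚᵘP.≃-trans (ℚP.toℚᵘ-homo-* (ι a) (ι b)) (ℚᵘP.*-cong (toℚᵘ-ι a) (toℚᵘ-ι b)))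
  (ℚᵘ.*≡* refl)

ι-neg : ∀ a → ι (ℤ.- a) ≡ - ι a
ι-neg a = viaℚᵘ (toℚᵘ-ι (ℤ.- a)) (ℚᵘP.≃-trans (ℚP.toℚᵘ-homo‿- (ι a)) (ℚᵘP.-‿cong (toℚᵘ-ι a))) (ℚᵘ.*≡* refl)

/suc≡ι*1/[1+] : ∀ z n → z / suc n ≡ ι z * 1/[1+ n ]
/suc≡ι*1/[1+] z n = viaℚᵘ (ℚP.toℚᵘ-fromℚᵘ (ℚᵘ.mkℚᵘ z n))
  (ℚᵘP.≃-trans (ℚP.toℚᵘ-homo-* (ι z) 1/[1+ n ]) (ℚᵘP.*-cong (toℚᵘ-ι z) (toℚᵘ-1/[1+] n)))
  (ℚᵘ.*≡* (cong₂ ℤ._*_ (sym (ℤP.*-identityʳ z)) (cong (λ k → + suc k) (ℕP.+-identityʳ n))))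

ι[1+n]*1/[1+n]≡1 : ∀ n → ι (+ suc n) * 1/[1+ n ] ≡ 1ℚ
ι[1+n]*1/[1+n]≡1 n = viaℚᵘ
  (ℚᵘP.≃-trans (ℚP.toℚᵘ-homo-* (ι (+ suc n)) 1/[1+ n ]) (ℚᵘP.*-cong (toℚᵘ-ι (+ suc n)) (toℚᵘ-1/[1+] n)))
  ℚᵘP.≃-refl
  (ℚᵘ.*≡* (trans (ℤP.*-identityʳ _)
    (trans (cong (λ k → + suc k) (trans (ℕP.*-identityʳ n) (sym (ℕP.+-identityʳ n)))) (sym (ℤP.*-identityˡ _)))))

ι[1+n]*x≡0⇒x≡0 : ∀ n x → ι (+ suc n) * x ≡ 0ℚ → x ≡ 0ℚ
ι[1+n]*x≡0⇒x≡0 n x h = begin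
  x                                  ≡⟨ ℚP.*-identityˡ x ⟨
  1ℚ * x                             ≡⟨ cong (_* x) (trans (ℚP.*-comm 1/[1+ n ] _) (ι[1+n]*1/[1+n]≡1 n)) ⟨
  1/[1+ n ] * ι (+ suc n) * x        ≡⟨ ℚP.*-assoc 1/[1+ n ] _ x ⟩
  1/[1+ n ] * (ι (+ suc n) * x)      ≡⟨ cong (1/[1+ n ] *_) h ⟩
  1/[1+ n ] * 0ℚ                     ≡⟨ ℚP.*-zeroʳ 1/[1+ n ] ⟩
  0ℚ                                 ∎
  where open ≡-Reasoning

sum-cong : ∀ n {f g : ℕ → ℚ} → (∀ i → i < n → f i ≡ g i) → sumℚ n f ≡ sumℚ n g
sum-cong zero    h = refl
sum-cong (suc n) h = cong₂ _+_ (sum-cong n (λ i i<n → h i (ℕP.m<n⇒m<1+n i<n))) (h n ℕP.≤-refl)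

sum-zero : ∀ n (f : ℕ → ℚ) → (∀ i → i < n → f i ≡ 0ℚ) → sumℚ n f ≡ 0ℚ
sum-zero n f h = trans (sum-cong n h) (zeros n)
  where
  zeros : ∀ n → sumℚ n (λ _ → 0ℚ) ≡ 0ℚ
  zeros zero    = refl
  zeros (suc n) = cong (_+ 0ℚ) (zeros n)

sum-+ : ∀ n (f g : ℕ → ℚ) → sumℚ n (λ i → f i + g i) ≡ sumℚ n f + sumℚ n g
sum-+ zero    f g = refl
sum-+ (suc n) f g = trans (cong (_+ (f n + g n)) (sum-+ n f g))
  (solve 4 (λ a b c d → (a :+ b) :+ (c :+ d) := (a :+ c) :+ (b :+ d)) refl (sumℚ n f) (sumℚ n g) (f n) (g n))

sum-- : ∀ n (f g : ℕ → ℚ) → sumℚ n (λ i → f i - g i) ≡ sumℚ n f - sumℚ n g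
sum-- zero    f g = refl
sum-- (suc n) f g = trans (cong (_+ (f n - g n)) (sum-- n f g))
  (solve 4 (λ a b c d → (a :- b) :+ (c :- d) := (a :+ c) :- (b :+ d)) refl (sumℚ n f) (sumℚ n g) (f n) (g n))

sum-*ˡ : ∀ n c (f : ℕ → ℚ) → sumℚ n (λ i → c * f i) ≡ c * sumℚ n f
sum-*ˡ zero    c f = sym (ℚP.*-zeroʳ c)
sum-*ˡ (suc n) c f = trans (cong (_+ (c * f n)) (sum-*ˡ n c f)) (sym (ℚP.*-distribˡ-+ c (sumℚ n f) (f n)))

sum-split : ∀ a b (f : ℕ → ℚ) → sumℚ (a ℕ.+ b) f ≡ sumℚ a f + sumℚ b (λ i → f (a ℕ.+ i))
sum-split a zero    f rewrite ℕP.+-identityʳ a = sym (ℚP.+-identityʳ _)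
sum-split a (suc b) f rewrite ℕP.+-suc a b =
  trans (cong (_+ f (a ℕ.+ b)) (sum-split a b f)) (ℚP.+-assoc (sumℚ a f) _ _)

sum-head : ∀ n (f : ℕ → ℚ) → sumℚ (suc n) f ≡ f 0 + sumℚ n (λ i → f (suc i))
sum-head n f = trans (sum-split 1 n f) (cong (_+ sumℚ n (λ i → f (suc i))) (ℚP.+-identityˡ (f 0)))

sum-reverse : ∀ n (f : ℕ → ℚ) → sumℚ (suc n) f ≡ sumℚ (suc n) (λ i → f (n ∸ i))
sum-reverse zero    f = refl
sum-reverse (suc n) f = trans (cong (_+ f (suc n)) (sum-reverse n f))
  (trans (ℚP.+-comm _ (f (suc n))) (sym (sum-head (suc n) (λ i → f (suc n ∸ i)))))

sum-swap : ∀ a b (f : ℕ → ℕ → ℚ) →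
           sumℚ a (λ i → sumℚ b (λ j → f i j)) ≡ sumℚ b (λ j → sumℚ a (λ i → f i j))
sum-swap zero    b f = sym (sum-zero b _ (λ _ _ → refl))
sum-swap (suc a) b f = trans (cong (_+ sumℚ b (f a)) (sum-swap a b f))
  (sym (sum-+ b (λ j → sumℚ a (λ i → f i j)) (f a)))

sum-vanishing-tail : ∀ {a b} (f : ℕ → ℚ) → a ≤ b → (∀ i → a ≤ i → f i ≡ 0ℚ) → sumℚ b f ≡ sumℚ a f
sum-vanishing-tail {a} f a≤b h with ℕP.m≤n⇒∃[o]m+o≡n a≤b
... | t , refl = trans (sum-split a t f) (trans (cong (λ x → sumℚ a f + x) tail≡0) (ℚP.+-identityʳ _))
  where
  tail≡0 : sumℚ t (λ i → f (a ℕ.+ i)) ≡ 0ℚ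
  tail≡0 = sum-zero t _ (λ i _ → h (a ℕ.+ i) (ℕP.m≤m+n a i))

δ : ℕ → ℕ → ℚ
δ zero    zero    = 1ℚ
δ zero    (suc i) = 0ℚ
δ (suc k) zero    = 0ℚ
δ (suc k) (suc i) = δ k i

δ-refl : ∀ k → δ k k ≡ 1ℚ
δ-refl zero    = refl
δ-refl (suc k) = δ-refl k

δ-≢ : ∀ {k i} → k ≢ i → δ k i ≡ 0ℚ
δ-≢ {zero}  {zero}  k≢i = ⊥-elim (k≢i refl)
δ-≢ {zero}  {suc i} k≢i = refl
δ-≢ {suc k} {zero}  k≢i = refl
δ-≢ {suc k} {suc i} k≢i = δ-≢ (k≢i ∘ cong suc)

sum-*δ≡0 : ∀ n (f : ℕ → ℚ) {i} → n ≤ i → sumℚ n (λ k → f k * δ k i) ≡ 0ℚ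
sum-*δ≡0 n f n≤i = sum-zero n _ (λ k k<n →
  trans (cong (f k *_) (δ-≢ (λ k≡i → ℕP.<-irrefl k≡i (ℕP.<-≤-trans k<n n≤i)))) (ℚP.*-zeroʳ (f k)))

sum-*δ : ∀ n (f : ℕ → ℚ) i → (∀ j → n ≤ j → f j ≡ 0ℚ) → sumℚ n (λ k → f k * δ k i) ≡ f i
sum-*δ n f i f-vanishes with i ℕ.<? n
... | no  i≮n = trans (sum-*δ≡0 n f (ℕP.≮⇒≥ i≮n)) (sym (f-vanishes i (ℕP.≮⇒≥ i≮n)))
... | yes i<n = inside n i<n
  where
  inside : ∀ n → i < n → sumℚ n (λ k → f k * δ k i) ≡ f i
  inside (suc n) i<1+n with i ℕ.≟ n
  ... | yes refl = trans (cong₂ _+_ (sum-*δ≡0 n f ℕP.≤-refl) (cong (f n *_) (δ-refl n)))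
    (solve 1 (λ x → con 0ℚ :+ x :* con 1ℚ := x) refl (f n))
  ... | no  i≢n  = trans (cong₂ _+_ (inside n (ℕP.≤∧≢⇒< (ℕP.≤-pred i<1+n) i≢n)) (cong (f n *_) (δ-≢ (i≢n ∘ sym))))
    (solve 2 (λ x y → x :+ y :* con 0ℚ := x) refl (f i) (f n))

signℚ-+ : ∀ a b → signℚ (a ℕ.+ b) ≡ signℚ a * signℚ b
signℚ-+ zero    b = sym (ℚP.*-identityˡ _)
signℚ-+ (suc a) b = trans (cong -_ (signℚ-+ a b)) (ℚP.neg-distribˡ-* (signℚ a) (signℚ b))

signℚ-square : ∀ a → signℚ a * signℚ a ≡ 1ℚ
signℚ-square zero    = refl
signℚ-square (suc a) = trans (solve 1 (λ x → (:- x) :* (:- x) := x :* x) refl (signℚ a)) (signℚ-square a)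

signℚ-double : ∀ a → signℚ (a ℕ.+ a) ≡ 1ℚ
signℚ-double a = trans (signℚ-+ a a) (signℚ-square a)

signℚ-conj : ∀ a b → signℚ (a ℕ.+ b ℕ.+ a) ≡ signℚ b
signℚ-conj a b = begin
  signℚ (a ℕ.+ b ℕ.+ a)          ≡⟨ trans (signℚ-+ (a ℕ.+ b) a) (cong (_* signℚ a) (signℚ-+ a b)) ⟩
  signℚ a * signℚ b * signℚ a    ≡⟨ solve 2 (λ x y → x :* y :* x := x :* x :* y) refl (signℚ a) (signℚ b) ⟩
  signℚ a * signℚ a * signℚ b    ≡⟨ cong (_* signℚ b) (signℚ-square a) ⟩
  1ℚ * signℚ b                   ≡⟨ ℚP.*-identityˡ (signℚ b) ⟩
  signℚ b                        ∎
  where open ≡-Reasoning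

signℚ-+-cancel : ∀ a b c → signℚ (a ℕ.+ b) * signℚ (b ℕ.+ c) ≡ signℚ (a ℕ.+ c)
signℚ-+-cancel a b c = begin
  signℚ (a ℕ.+ b) * signℚ (b ℕ.+ c)
    ≡⟨ cong₂ _*_ (signℚ-+ a b) (signℚ-+ b c) ⟩
  signℚ a * signℚ b * (signℚ b * signℚ c)
    ≡⟨ solve 3 (λ x y z → x :* y :* (y :* z) := x :* z :* (y :* y)) refl (signℚ a) (signℚ b) (signℚ c) ⟩
  signℚ a * signℚ c * (signℚ b * signℚ b)
    ≡⟨ cong (signℚ a * signℚ c *_) (signℚ-square b) ⟩
  signℚ a * signℚ c * 1ℚ
    ≡⟨ ℚP.*-identityʳ _ ⟩
  signℚ a * signℚ c
    ≡⟨ signℚ-+ a c ⟨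
  signℚ (a ℕ.+ c)
    ∎
  where open ≡-Reasoning

[m+n]Cm*m!*n!≡[m+n]! : ∀ m n → ((m ℕ.+ n) C m) ℕ.* (m ! ℕ.* n !) ≡ (m ℕ.+ n) !
[m+n]Cm*m!*n!≡[m+n]! m n = begin
  ((m ℕ.+ n) C m) ℕ.* (m ! ℕ.* n !)                 ≡⟨ cong (λ k → ((m ℕ.+ n) C m) ℕ.* (m ! ℕ.* k !)) (ℕP.m+n∸m≡n m n) ⟨
  ((m ℕ.+ n) C m) ℕ.* (m ! ℕ.* ((m ℕ.+ n) ∸ m) !)   ≡⟨ cong (ℕ._* (m ! ℕ.* ((m ℕ.+ n) ∸ m) !)) (nCk≡n!/k![n-k]! m≤m+n) ⟩
  _                                                  ≡⟨ m/n*n≡m {{ℕP._!*_!≢0 m ((m ℕ.+ n) ∸ m)}} (k![n∸k]!∣n! m≤m+n) ⟩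
  (m ℕ.+ n) !                                        ∎
  where
  open ≡-Reasoning
  m≤m+n = ℕP.m≤m+n m n

-- Both sides equal (i + t + r)! / (i! t! r!).
C*C-revision : ∀ i t r → ((i ℕ.+ (t ℕ.+ r)) C (i ℕ.+ t)) ℕ.* ((i ℕ.+ t) C i)
                         ≡ ((i ℕ.+ (t ℕ.+ r)) C i) ℕ.* ((t ℕ.+ r) C t)
C*C-revision i t r = ℕP.*-cancelʳ-≡ _ _ (i ! ℕ.* (t ! ℕ.* r !)) {{ℕP.m*n≢0 _ _ {{ℕP._!≢0 i}} {{ℕP._!*_!≢0 t r}}}} (begin
  (a ℕ.* b) ℕ.* (i ! ℕ.* (t ! ℕ.* r !))
    ≡⟨ regroupˡ a b (i !) (t !) (r !) ⟩
  a ℕ.* ((b ℕ.* (i ! ℕ.* t !)) ℕ.* r !)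
    ≡⟨ cong (λ x → a ℕ.* (x ℕ.* r !)) ([m+n]Cm*m!*n!≡[m+n]! i t) ⟩
  a ℕ.* ((i ℕ.+ t) ! ℕ.* r !)
    ≡⟨ subst (λ n → (n C (i ℕ.+ t)) ℕ.* ((i ℕ.+ t) ! ℕ.* r !) ≡ n !) (ℕP.+-assoc i t r) ([m+n]Cm*m!*n!≡[m+n]! (i ℕ.+ t) r) ⟩
  (i ℕ.+ (t ℕ.+ r)) !
    ≡⟨ [m+n]Cm*m!*n!≡[m+n]! i (t ℕ.+ r) ⟨
  c ℕ.* (i ! ℕ.* (t ℕ.+ r) !)
    ≡⟨ cong (λ x → c ℕ.* (i ! ℕ.* x)) ([m+n]Cm*m!*n!≡[m+n]! t r) ⟨
  c ℕ.* (i ! ℕ.* (d ℕ.* (t ! ℕ.* r !)))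
    ≡⟨ regroupʳ c d (i !) (t !) (r !) ⟩
  (c ℕ.* d) ℕ.* (i ! ℕ.* (t ! ℕ.* r !))
    ∎)
  where
  open ≡-Reasoning
  regroupˡ : ∀ a b x y z → (a ℕ.* b) ℕ.* (x ℕ.* (y ℕ.* z)) ≡ a ℕ.* ((b ℕ.* (x ℕ.* y)) ℕ.* z)
  regroupˡ = solve-∀
  regroupʳ : ∀ c d x y z → c ℕ.* (x ℕ.* (d ℕ.* (y ℕ.* z))) ≡ (c ℕ.* d) ℕ.* (x ℕ.* (y ℕ.* z))
  regroupʳ = solve-∀
  a = (i ℕ.+ (t ℕ.+ r)) C (i ℕ.+ t)
  b = (i ℕ.+ t) C i
  c = (i ℕ.+ (t ℕ.+ r)) C i
  d = (t ℕ.+ r) C t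

Cℚ : ℕ → ℕ → ℚ
Cℚ n k = ι (+ (n C k))

Cℚ-vanish : ∀ {n k} → n < k → Cℚ n k ≡ 0ℚ
Cℚ-vanish n<k = cong (ι ∘ +_) (k>n⇒nCk≡0 n<k)

Cℚ-pascal : ∀ n k → Cℚ (suc n) (suc k) ≡ Cℚ n k + Cℚ n (suc k)
Cℚ-pascal n k = trans (cong (ι ∘ +_) (sym (nCk+nC[k+1]≡[n+1]C[k+1] n k)))
  (trans (cong ι (ℤP.pos-+ (n C k) (n C suc k))) (ι-+ (+ (n C k)) (+ (n C suc k))))

Cℚ-symmetric : ∀ {n k} → k ≤ n → Cℚ n k ≡ Cℚ n (n ∸ k)
Cℚ-symmetric k≤n = cong (ι ∘ +_) (nCk≡nC[n∸k] k≤n)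

Cℚ-diagonal : ∀ n → Cℚ n n ≡ 1ℚ
Cℚ-diagonal n = cong (ι ∘ +_) (nCn≡1 n)

Cℚ-subdiagonal : ∀ n → Cℚ (suc n) n ≡ ι (+ suc n)
Cℚ-subdiagonal n = cong (ι ∘ +_)
  (trans (nCk≡nC[n∸k] (ℕP.n≤1+n n)) (trans (cong (suc n C_) (ℕP.m+n∸n≡m 1 n)) (nC1≡n (suc n))))

Cℚ*Cℚ-revision : ∀ i t r → Cℚ (i ℕ.+ (t ℕ.+ r)) (i ℕ.+ t) * Cℚ (i ℕ.+ t) i
                           ≡ Cℚ (i ℕ.+ (t ℕ.+ r)) i * Cℚ (t ℕ.+ r) t
Cℚ*Cℚ-revision i t r = trans (sym (ι-+* ((i ℕ.+ (t ℕ.+ r)) C (i ℕ.+ t)) ((i ℕ.+ t) C i)))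
  (trans (cong (ι ∘ +_) (C*C-revision i t r)) (ι-+* ((i ℕ.+ (t ℕ.+ r)) C i) ((t ℕ.+ r) C t)))
  where
  ι-+* : ∀ a b → ι (+ (a ℕ.* b)) ≡ ι (+ a) * ι (+ b)
  ι-+* a b = trans (cong ι (ℤP.pos-* a b)) (ι-* (+ a) (+ b))

-- Bernoulli numbers

length-bernoulliList : ∀ n → length (bernoulliList n) ≡ n
length-bernoulliList zero          = refl
length-bernoulliList (suc zero)    = refl
length-bernoulliList (suc (suc k)) = trans (ListP.length-++ (bernoulliList (suc k)))
  (trans (cong (ℕ._+ 1) (length-bernoulliList (suc k))) (ℕP.+-comm (suc k) 1))

nth-++ˡ : ∀ (xs ys : List ℚ) {i} → i < length xs → nth (xs ++ ys) i ≡ nth xs i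
nth-++ˡ (x ∷ xs) ys {zero}  _         = refl
nth-++ˡ (x ∷ xs) ys {suc i} (s≤s i<n) = nth-++ˡ xs ys i<n

nth-++-last : ∀ (xs : List ℚ) y → nth (xs ++ [ y ]) (length xs) ≡ y
nth-++-last []       y = refl
nth-++-last (x ∷ xs) y = nth-++-last xs y

nth-bernoulliList : ∀ {i n} → i < n → nth (bernoulliList n) i ≡ bernoulli i
nth-bernoulliList {i} i<n with ℕP.m≤n⇒∃[o]m+o≡n i<n
... | t , refl = prefix t
  where
  prefix : ∀ t → nth (bernoulliList (suc i ℕ.+ t)) i ≡ bernoulli i
  prefix zero    rewrite ℕP.+-identityʳ i = refl
  prefix (suc t) rewrite ℕP.+-suc i t = trans (nth-++ˡ (bernoulliList (suc (i ℕ.+ t))) _ i<len) (prefix t)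
    where
    i<len : i < length (bernoulliList (suc (i ℕ.+ t)))
    i<len = subst (i <_) (sym (length-bernoulliList (suc (i ℕ.+ t)))) (s≤s (ℕP.m≤m+n i t))

bernoulli-recurrence : ∀ k → sumℚ (suc (suc k)) (λ i → Cℚ (suc (suc k)) i * bernoulli i) ≡ 0ℚ
bernoulli-recurrence k = begin
  S + Cℚ (suc (suc k)) (suc k) * bernoulli (suc k)
    ≡⟨ cong₂ (λ x y → S + x * y) (Cℚ-subdiagonal (suc k)) bernoulli[1+k] ⟩
  S + ι (+ suc (suc k)) * (- (1/[1+ suc k ] * S))
    ≡⟨ solve 3 (λ s a b → s :+ a :* (:- (b :* s)) := s :- (a :* b) :* s) refl S (ι (+ suc (suc k))) 1/[1+ suc k ] ⟩
  S - ι (+ suc (suc k)) * 1/[1+ suc k ] * S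
    ≡⟨ cong (λ z → S - z * S) (ι[1+n]*1/[1+n]≡1 (suc k)) ⟩
  S - 1ℚ * S
    ≡⟨ solve 1 (λ s → s :- con 1ℚ :* s := con 0ℚ) refl S ⟩
  0ℚ
    ∎
  where
  open ≡-Reasoning
  bs = bernoulliList (suc k)
  S = sumℚ (suc k) (λ i → Cℚ (suc (suc k)) i * bernoulli i)
  S≡ : sumℚ (suc k) (λ i → Cℚ (suc (suc k)) i * nth bs i) ≡ S
  S≡ = sum-cong (suc k) (λ i i<1+k → cong (Cℚ (suc (suc k)) i *_) (nth-bernoulliList i<1+k))
  bernoulli[1+k] : bernoulli (suc k) ≡ - (1/[1+ suc k ] * S)
  bernoulli[1+k] = trans (subst (λ n → nth (bs ++ [ new ]) n ≡ new) (length-bernoulliList (suc k)) (nth-++-last bs new))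
    (cong (λ z → - (1/[1+ suc k ] * z)) S≡)
    where new = - (1/[1+ suc k ] * sumℚ (suc k) (λ i → Cℚ (suc (suc k)) i * nth bs i))

bernoulliAtOne : ℕ → ℚ
bernoulliAtOne n = sumℚ (suc n) (λ d → Cℚ n d * bernoulli d)

bernoulli-atOne : ∀ n → bernoulli n - bernoulliAtOne n ≡ - δ 1 n
bernoulli-atOne zero          = refl
bernoulli-atOne (suc zero)    = refl
bernoulli-atOne (suc (suc k)) = begin
  b - (sumℚ (suc (suc k)) (λ i → Cℚ (suc (suc k)) i * bernoulli i) + Cℚ (suc (suc k)) (suc (suc k)) * b)
    ≡⟨ cong₂ (λ x y → b - (x + y * b)) (bernoulli-recurrence k) (Cℚ-diagonal (suc (suc k))) ⟩
  b - (0ℚ + 1ℚ * b)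
    ≡⟨ solve 1 (λ b → b :- (con 0ℚ :+ con 1ℚ :* b) := con 0ℚ) refl b ⟩
  0ℚ
    ≡⟨ cong -_ (δ-≢ {1} {suc (suc k)} (λ ())) ⟨
  - δ 1 (suc (suc k))
    ∎
  where
  open ≡-Reasoning
  b = bernoulli (suc (suc k))

bernoulliAtOne-reverse : ∀ n → sumℚ (suc n) (λ t → Cℚ n t * bernoulli (n ∸ t)) ≡ bernoulliAtOne n
bernoulliAtOne-reverse n = trans (sum-reverse n _) (sum-cong (suc n) (λ d d<1+n →
  let d≤n = ℕP.≤-pred d<1+n in
  cong₂ _*_ (sym (Cℚ-symmetric d≤n)) (cong bernoulli (ℕP.m∸[m∸n]≡n d≤n))))

-- Coefficient sequences and the backward difference

mulX : (ℕ → ℚ) → ℕ → ℚ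
mulX p zero    = 0ℚ
mulX p (suc i) = p i

mulX-cong : ∀ {p q : ℕ → ℚ} → (∀ i → p i ≡ q i) → ∀ i → mulX p i ≡ mulX q i
mulX-cong p≡q zero    = refl
mulX-cong p≡q (suc i) = p≡q i

mul1+X : (ℕ → ℚ) → ℕ → ℚ
mul1+X p i = p i + mulX p i

mul1+X-mulX-commute : ∀ c (p q : ℕ → ℚ) → (∀ i → q i ≡ mulX p i - c * p i) →
                      ∀ i → mul1+X q i ≡ mulX (mul1+X p) i - c * mul1+X p i
mul1+X-mulX-commute c p q q≡ zero = trans (cong (_+ 0ℚ) (q≡ zero))
  (solve 2 (λ c x → (con 0ℚ :- c :* x) :+ con 0ℚ := con 0ℚ :- c :* (x :+ con 0ℚ)) refl c (p 0))
mul1+X-mulX-commute c p q q≡ (suc i) = trans (cong₂ _+_ (q≡ (suc i)) (q≡ i))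
  (solve 4 (λ c x y z → (x :- c :* y) :+ (z :- c :* x) := (x :+ z) :- c :* (y :+ x)) refl c (p i) (p (suc i)) (mulX p i))

xMinus1Pow : ℕ → ℕ → ℚ
xMinus1Pow j i = Cℚ j i * signℚ (j ℕ.+ i)

xMinus1Pow-vanish : ∀ {j i} → j < i → xMinus1Pow j i ≡ 0ℚ
xMinus1Pow-vanish {j} {i} j<i = trans (cong (_* signℚ (j ℕ.+ i)) (Cℚ-vanish j<i)) (ℚP.*-zeroˡ (signℚ (j ℕ.+ i)))

-- The coefficients of p(x − 1), for a coefficient sequence p vanishing from index b on.
shiftBack : ℕ → (ℕ → ℚ) → ℕ → ℚ
shiftBack b p i = sumℚ b (λ j → p j * xMinus1Pow j i)

∇ : ℕ → (ℕ → ℚ) → ℕ → ℚ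
∇ b p i = p i - shiftBack b p i

shiftBack-cong : ∀ b {p q : ℕ → ℚ} i → (∀ j → p j ≡ q j) → shiftBack b p i ≡ shiftBack b q i
shiftBack-cong b i p≡q = sum-cong b (λ j _ → cong (_* xMinus1Pow j i) (p≡q j))

shiftBack-- : ∀ b (p q : ℕ → ℚ) i → shiftBack b (λ j → p j - q j) i ≡ shiftBack b p i - shiftBack b q i
shiftBack-- b p q i = trans (sum-cong b (λ j _ → distrib j))
  (sum-- b (λ j → p j * xMinus1Pow j i) (λ j → q j * xMinus1Pow j i))
  where
  distrib : ∀ j → (p j - q j) * xMinus1Pow j i ≡ p j * xMinus1Pow j i - q j * xMinus1Pow j i
  distrib j = solve 3 (λ x y κ → (x :- y) :* κ := x :* κ :- y :* κ) refl (p j) (q j) (xMinus1Pow j i)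

shiftBack-*ˡ : ∀ b c (p : ℕ → ℚ) i → shiftBack b (λ j → c * p j) i ≡ c * shiftBack b p i
shiftBack-*ˡ b c p i = trans (sum-cong b (λ j _ → ℚP.*-assoc c (p j) (xMinus1Pow j i)))
  (sum-*ˡ b c (λ j → p j * xMinus1Pow j i))

shiftBack-sum : ∀ b n (g : ℕ → ℕ → ℚ) i →
                shiftBack b (λ j → sumℚ n (λ k → g k j)) i ≡ sumℚ n (λ k → shiftBack b (g k) i)
shiftBack-sum b n g i = trans (sum-cong b (λ j _ → distrib j)) (sum-swap b n (λ j k → g k j * xMinus1Pow j i))
  where
  distrib : ∀ j → sumℚ n (λ k → g k j) * xMinus1Pow j i ≡ sumℚ n (λ k → g k j * xMinus1Pow j i)
  distrib j = begin
    sumℚ n (λ k → g k j) * xMinus1Pow j i        ≡⟨ ℚP.*-comm (sumℚ n (λ k → g k j)) (xMinus1Pow j i) ⟩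
    xMinus1Pow j i * sumℚ n (λ k → g k j)        ≡⟨ sum-*ˡ n (xMinus1Pow j i) (λ k → g k j) ⟨
    sumℚ n (λ k → xMinus1Pow j i * g k j)        ≡⟨ sum-cong n (λ k _ → ℚP.*-comm (xMinus1Pow j i) (g k j)) ⟩
    sumℚ n (λ k → g k j * xMinus1Pow j i)        ∎
    where open ≡-Reasoning

shiftBack-bound : ∀ {b b'} (p : ℕ → ℚ) i → b ≤ b' → (∀ j → b ≤ j → p j ≡ 0ℚ) → shiftBack b' p i ≡ shiftBack b p i
shiftBack-bound p i b≤b' p-vanishes = sum-vanishing-tail (λ j → p j * xMinus1Pow j i) b≤b' (λ j b≤j →
  trans (cong (_* xMinus1Pow j i) (p-vanishes j b≤j)) (ℚP.*-zeroˡ (xMinus1Pow j i)))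

shiftBack-mulX : ∀ b (p : ℕ → ℚ) i → shiftBack (suc b) (mulX p) i ≡ mulX (shiftBack b p) i - shiftBack b p i
shiftBack-mulX b p zero = begin
  shiftBack (suc b) (mulX p) 0
    ≡⟨ sum-head b (λ j → mulX p j * xMinus1Pow j 0) ⟩
  0ℚ * xMinus1Pow 0 0 + sumℚ b (λ j → p j * (1ℚ * - s j))
    ≡⟨ cong₂ _+_ (ℚP.*-zeroˡ (xMinus1Pow 0 0)) (sum-cong b (λ j _ → negate j)) ⟩
  0ℚ + sumℚ b (λ j → - 1ℚ * (p j * xMinus1Pow j 0))
    ≡⟨ cong (λ x → 0ℚ + x) (sum-*ˡ b (- 1ℚ) (λ j → p j * xMinus1Pow j 0)) ⟩
  0ℚ + - 1ℚ * shiftBack b p 0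
    ≡⟨ solve 1 (λ x → con 0ℚ :+ con (- 1ℚ) :* x := con 0ℚ :- x) refl (shiftBack b p 0) ⟩
  0ℚ - shiftBack b p 0
    ∎
  where
  open ≡-Reasoning
  s : ℕ → ℚ
  s j = signℚ (j ℕ.+ 0)
  negate : ∀ j → p j * (1ℚ * - s j) ≡ - 1ℚ * (p j * (1ℚ * s j))
  negate j = solve 2 (λ x y → x :* (con 1ℚ :* (:- y)) := con (- 1ℚ) :* (x :* (con 1ℚ :* y))) refl (p j) (s j)
shiftBack-mulX b p (suc i) = begin
  shiftBack (suc b) (mulX p) (suc i)
    ≡⟨ sum-head b (λ j → mulX p j * xMinus1Pow j (suc i)) ⟩
  0ℚ * xMinus1Pow 0 (suc i) + sumℚ b (λ j → p j * xMinus1Pow (suc j) (suc i))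
    ≡⟨ cong₂ _+_ (ℚP.*-zeroˡ (xMinus1Pow 0 (suc i))) (sum-cong b (λ j _ → pascal j)) ⟩
  0ℚ + sumℚ b (λ j → p j * xMinus1Pow j i - p j * xMinus1Pow j (suc i))
    ≡⟨ trans (ℚP.+-identityˡ _) (sum-- b (λ j → p j * xMinus1Pow j i) (λ j → p j * xMinus1Pow j (suc i))) ⟩
  shiftBack b p i - shiftBack b p (suc i)
    ∎
  where
  open ≡-Reasoning
  pascal : ∀ j → p j * xMinus1Pow (suc j) (suc i) ≡ p j * xMinus1Pow j i - p j * xMinus1Pow j (suc i)
  pascal j = begin
    p j * (Cℚ (suc j) (suc i) * - t)
      ≡⟨ cong (λ c → p j * (c * - t)) (Cℚ-pascal j i) ⟩
    p j * ((a + c) * - t)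
      ≡⟨ cong (λ z → p j * ((a + c) * - z)) t≡-s ⟩
    p j * ((a + c) * - (- s))
      ≡⟨ solve 4 (λ x a c s → x :* ((a :+ c) :* (:- (:- s))) := x :* (a :* s) :- x :* (c :* (:- s))) refl (p j) a c s ⟩
    p j * (a * s) - p j * (c * - s)
      ≡⟨ cong (λ z → p j * (a * s) - p j * (c * z)) t≡-s ⟨
    p j * (a * s) - p j * (c * t)
      ∎
    where
    a = Cℚ j i
    c = Cℚ j (suc i)
    s = signℚ (j ℕ.+ i)
    t = signℚ (j ℕ.+ suc i)
    t≡-s : t ≡ - s
    t≡-s = cong signℚ (ℕP.+-suc j i)

∇-*ˡ : ∀ b c (p : ℕ → ℚ) i → ∇ b (λ j → c * p j) i ≡ c * ∇ b p i
∇-*ˡ b c p i = trans (cong (λ x → c * p i - x) (shiftBack-*ˡ b c p i))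
  (solve 3 (λ c x y → c :* x :- c :* y := c :* (x :- y)) refl c (p i) (shiftBack b p i))

∇-- : ∀ b (p q : ℕ → ℚ) i → ∇ b (λ j → p j - q j) i ≡ ∇ b p i - ∇ b q i
∇-- b p q i = trans (cong (λ x → (p i - q i) - x) (shiftBack-- b p q i))
  (solve 4 (λ x y u v → (x :- y) :- (u :- v) := (x :- u) :- (y :- v)) refl (p i) (q i) (shiftBack b p i) (shiftBack b q i))

∇-sum-*ˡ : ∀ b n (c : ℕ → ℚ) (g : ℕ → ℕ → ℚ) i →
           ∇ b (λ j → sumℚ n (λ k → c k * g k j)) i ≡ sumℚ n (λ k → c k * ∇ b (g k) i)
∇-sum-*ˡ b n c g i = begin
  sumℚ n (λ k → c k * g k i) - shiftBack b (λ j → sumℚ n (λ k → c k * g k j)) i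
    ≡⟨ cong (λ x → sumℚ n (λ k → c k * g k i) - x) (shiftBack-sum b n (λ k j → c k * g k j) i) ⟩
  sumℚ n (λ k → c k * g k i) - sumℚ n (λ k → shiftBack b (λ j → c k * g k j) i)
    ≡⟨ cong (λ x → sumℚ n (λ k → c k * g k i) - x) (sum-cong n (λ k _ → shiftBack-*ˡ b (c k) (g k) i)) ⟩
  sumℚ n (λ k → c k * g k i) - sumℚ n (λ k → c k * shiftBack b (g k) i)
    ≡⟨ sum-- n (λ k → c k * g k i) (λ k → c k * shiftBack b (g k) i) ⟨
  sumℚ n (λ k → c k * g k i - c k * shiftBack b (g k) i)
    ≡⟨ sum-cong n (λ k _ → solve 3 (λ c x y → c :* x :- c :* y := c :* (x :- y)) refl (c k) (g k i) (shiftBack b (g k) i)) ⟩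
  sumℚ n (λ k → c k * ∇ b (g k) i)
    ∎
  where open ≡-Reasoning

∇-bound : ∀ {b b'} (p : ℕ → ℚ) i → b ≤ b' → (∀ j → b ≤ j → p j ≡ 0ℚ) → ∇ b' p i ≡ ∇ b p i
∇-bound p i b≤b' p-vanishes = cong (λ x → p i - x) (shiftBack-bound p i b≤b' p-vanishes)

∇-top : ∀ {b} M (p : ℕ → ℚ) → suc (suc M) ≤ b → (∀ j → suc M < j → p j ≡ 0ℚ) →
        ∇ b p M ≡ ι (+ suc M) * p (suc M)
∇-top {b} M p M+2≤b p-vanishes = begin
  p M - shiftBack b p M                         ≡⟨ cong (λ x → p M - x) (shiftBack-bound p M M+2≤b p-vanishes) ⟩
  p M - ((sumℚ M f + f M) + f (suc M))          ≡⟨ cong (λ x → p M - ((x + f M) + f (suc M))) below ⟩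
  p M - ((0ℚ + f M) + f (suc M))                ≡⟨ cong₂ (λ x y → p M - ((0ℚ + p M * x) + p (suc M) * y)) diagonal subdiagonal ⟩
  p M - ((0ℚ + p M * 1ℚ) + p (suc M) * (ι (+ suc M) * - 1ℚ))
    ≡⟨ solve 3 (λ a b c → a :- ((con 0ℚ :+ a :* con 1ℚ) :+ b :* (c :* (:- con 1ℚ))) := c :* b) refl (p M) (p (suc M)) (ι (+ suc M)) ⟩
  ι (+ suc M) * p (suc M)                       ∎
  where
  open ≡-Reasoning
  f : ℕ → ℚ
  f j = p j * xMinus1Pow j M
  below : sumℚ M f ≡ 0ℚ
  below = sum-zero M f (λ j j<M → trans (cong (p j *_) (xMinus1Pow-vanish j<M)) (ℚP.*-zeroʳ (p j)))
  diagonal : Cℚ M M * signℚ (M ℕ.+ M) ≡ 1ℚ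
  diagonal = cong₂ _*_ (Cℚ-diagonal M) (signℚ-double M)
  subdiagonal : Cℚ (suc M) M * signℚ (suc M ℕ.+ M) ≡ ι (+ suc M) * - 1ℚ
  subdiagonal = cong₂ _*_ (Cℚ-subdiagonal M) (cong -_ (signℚ-double M))

-- Downward induction on the degree: ∇-top kills the top coefficient at each step.
∇≡0⇒constant : ∀ n (p : ℕ → ℚ) → (∀ j → suc n ≤ j → p j ≡ 0ℚ) → (∀ i → ∇ (suc n) p i ≡ 0ℚ) →
               ∀ j → p (suc j) ≡ 0ℚ
∇≡0⇒constant n p p-vanishes ∇p≡0 j = vanishesAbove n ℕP.≤-refl p-vanishes (suc j) (s≤s z≤n)
  where
  vanishesAbove : ∀ M → M ≤ n → (∀ k → M < k → p k ≡ 0ℚ) → ∀ k → 0 < k → p k ≡ 0ℚ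
  vanishesAbove zero    _     above = above
  vanishesAbove (suc M) 1+M≤n above = vanishesAbove M (ℕP.<⇒≤ 1+M≤n) above′
    where
    p[1+M]≡0 : p (suc M) ≡ 0ℚ
    p[1+M]≡0 = ι[1+n]*x≡0⇒x≡0 M (p (suc M)) (trans (sym (∇-top M p (s≤s 1+M≤n) above)) (∇p≡0 M))
    above′ : ∀ k → M < k → p k ≡ 0ℚ
    above′ k M<k with k ℕ.≟ suc M
    ... | yes refl = p[1+M]≡0
    ... | no  k≢1+M = above k (ℕP.≤∧≢⇒< M<k (k≢1+M ∘ sym))

-- Antidifferences of powers

-- The coefficients of (−1)ᴷ Bᴷ(−x), where Bᴷ(x) = Σᵢ C(K, i) B_{K−i} xⁱ is the K-th Bernoulli polynomial.
bernoulliReflected : ℕ → ℕ → ℚ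
bernoulliReflected K i = xMinus1Pow K i * bernoulli (K ∸ i)

bernoulliReflected-revision : ∀ i t r →
  bernoulliReflected (i ℕ.+ (t ℕ.+ r)) (i ℕ.+ t) * xMinus1Pow (i ℕ.+ t) i
    ≡ Cℚ (i ℕ.+ (t ℕ.+ r)) i * signℚ (t ℕ.+ r) * (Cℚ (t ℕ.+ r) t * bernoulli ((t ℕ.+ r) ∸ t))
bernoulliReflected-revision i t r = begin
  Cℚ K (i ℕ.+ t) * signℚ (K ℕ.+ (i ℕ.+ t)) * b * (Cℚ (i ℕ.+ t) i * signℚ (i ℕ.+ t ℕ.+ i))
    ≡⟨ solve 5 (λ c₁ s₁ b c₂ s₂ → c₁ :* s₁ :* b :* (c₂ :* s₂) := (c₁ :* c₂) :* (s₁ :* s₂) :* b) refl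
         (Cℚ K (i ℕ.+ t)) (signℚ (K ℕ.+ (i ℕ.+ t))) b (Cℚ (i ℕ.+ t) i) (signℚ (i ℕ.+ t ℕ.+ i)) ⟩
  (Cℚ K (i ℕ.+ t) * Cℚ (i ℕ.+ t) i) * (signℚ (K ℕ.+ (i ℕ.+ t)) * signℚ (i ℕ.+ t ℕ.+ i)) * b
    ≡⟨ cong₂ (λ x y → x * y * b) (Cℚ*Cℚ-revision i t r) (trans (signℚ-+-cancel K (i ℕ.+ t) i) (signℚ-conj i n)) ⟩
  (Cℚ K i * Cℚ n t) * signℚ n * b
    ≡⟨ cong (λ z → (Cℚ K i * Cℚ n t) * signℚ n * bernoulli z) (ℕP.[m+n]∸[m+o]≡n∸o i n t) ⟩
  (Cℚ K i * Cℚ n t) * signℚ n * bernoulli (n ∸ t)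
    ≡⟨ solve 4 (λ a b c d → (a :* b) :* c :* d := a :* c :* (b :* d)) refl (Cℚ K i) (Cℚ n t) (signℚ n) (bernoulli (n ∸ t)) ⟩
  Cℚ K i * signℚ n * (Cℚ n t * bernoulli (n ∸ t))
    ∎
  where
  open ≡-Reasoning
  n = t ℕ.+ r
  K = i ℕ.+ n
  b = bernoulli (K ∸ (i ℕ.+ t))

shiftBack-bernoulliReflected : ∀ i n →
  shiftBack (suc (i ℕ.+ n)) (bernoulliReflected (i ℕ.+ n)) i ≡ Cℚ (i ℕ.+ n) i * signℚ n * bernoulliAtOne n
shiftBack-bernoulliReflected i n = begin
  sumℚ (suc (i ℕ.+ n)) f                                  ≡⟨ cong (λ z → sumℚ z f) (ℕP.+-suc i n) ⟨
  sumℚ (i ℕ.+ suc n) f                                    ≡⟨ sum-split i (suc n) f ⟩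
  sumℚ i f + sumℚ (suc n) (λ t → f (i ℕ.+ t))             ≡⟨ cong₂ _+_ (sum-zero i f below) (sum-cong (suc n) above) ⟩
  0ℚ + sumℚ (suc n) (λ t → c * (Cℚ n t * bernoulli (n ∸ t)))
                                                          ≡⟨ trans (ℚP.+-identityˡ _) (sum-*ˡ (suc n) c (λ t → Cℚ n t * bernoulli (n ∸ t))) ⟩
  c * sumℚ (suc n) (λ t → Cℚ n t * bernoulli (n ∸ t))    ≡⟨ cong (c *_) (bernoulliAtOne-reverse n) ⟩
  c * bernoulliAtOne n                                    ∎
  where
  open ≡-Reasoning
  c = Cℚ (i ℕ.+ n) i * signℚ n
  f : ℕ → ℚ
  f j = bernoulliReflected (i ℕ.+ n) j * xMinus1Pow j i
  below : ∀ j → j < i → f j ≡ 0ℚ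
  below j j<i = trans (cong (bernoulliReflected (i ℕ.+ n) j *_) (xMinus1Pow-vanish j<i)) (ℚP.*-zeroʳ (bernoulliReflected (i ℕ.+ n) j))
  above : ∀ t → t < suc n → f (i ℕ.+ t) ≡ c * (Cℚ n t * bernoulli (n ∸ t))
  above t t<1+n with ℕP.m≤n⇒∃[o]m+o≡n (ℕP.≤-pred t<1+n)
  ... | r , refl = bernoulliReflected-revision i t r

∇-bernoulliReflected-beyond : ∀ {K i} → K < i → ∇ (suc K) (bernoulliReflected K) i ≡ ι (+ K) * δ K (suc i)
∇-bernoulliReflected-beyond {K} {i} K<i = begin
  bernoulliReflected K i - shiftBack (suc K) (bernoulliReflected K) i
    ≡⟨ cong₂ _-_ (trans (cong (_* bernoulli (K ∸ i)) (xMinus1Pow-vanish K<i)) (ℚP.*-zeroˡ (bernoulli (K ∸ i))))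
                 (sum-zero (suc K) (λ j → bernoulliReflected K j * xMinus1Pow j i) (λ j j≤K →
                   trans (cong (bernoulliReflected K j *_) (xMinus1Pow-vanish (ℕP.≤-<-trans (ℕP.≤-pred j≤K) K<i)))
                         (ℚP.*-zeroʳ (bernoulliReflected K j)))) ⟩
  0ℚ - 0ℚ
    ≡⟨ solve 1 (λ k → con 0ℚ :- con 0ℚ := k :* con 0ℚ) refl (ι (+ K)) ⟩
  ι (+ K) * 0ℚ
    ≡⟨ cong (ι (+ K) *_) (δ-≢ (λ K≡1+i → ℕP.<-asym K<i (subst (i <_) (sym K≡1+i) ℕP.≤-refl))) ⟨
  ι (+ K) * δ K (suc i)
    ∎
  where open ≡-Reasoning

∇-bernoulliReflected-within : ∀ i n →
  ∇ (suc (i ℕ.+ n)) (bernoulliReflected (i ℕ.+ n)) i ≡ ι (+ (i ℕ.+ n)) * δ (i ℕ.+ n) (suc i)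
∇-bernoulliReflected-within i n = trans (cong₂ _-_ diagonal (shiftBack-bernoulliReflected i n)) (byExcess n)
  where
  diagonal : bernoulliReflected (i ℕ.+ n) i ≡ Cℚ (i ℕ.+ n) i * signℚ n * bernoulli n
  diagonal = cong₂ (λ s b → Cℚ (i ℕ.+ n) i * s * bernoulli b) (signℚ-conj i n) (ℕP.m+n∸m≡n i n)
  byExcess : ∀ n → Cℚ (i ℕ.+ n) i * signℚ n * bernoulli n - Cℚ (i ℕ.+ n) i * signℚ n * bernoulliAtOne n
                   ≡ ι (+ (i ℕ.+ n)) * δ (i ℕ.+ n) (suc i)
  byExcess n = begin
    c * bernoulli n - c * bernoulliAtOne n
      ≡⟨ solve 3 (λ c x y → c :* x :- c :* y := c :* (x :- y)) refl c (bernoulli n) (bernoulliAtOne n) ⟩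
    c * (bernoulli n - bernoulliAtOne n)
      ≡⟨ cong (c *_) (bernoulli-atOne n) ⟩
    c * - δ 1 n
      ≡⟨ onlyOne n ⟩
    ι (+ (i ℕ.+ n)) * δ (i ℕ.+ n) (suc i)
      ∎
    where
    open ≡-Reasoning
    c = Cℚ (i ℕ.+ n) i * signℚ n
    onlyOne : ∀ n → Cℚ (i ℕ.+ n) i * signℚ n * - δ 1 n ≡ ι (+ (i ℕ.+ n)) * δ (i ℕ.+ n) (suc i)
    onlyOne zero = begin
      Cℚ (i ℕ.+ 0) i * 1ℚ * - 0ℚ
        ≡⟨ solve 2 (λ x y → x :* con 1ℚ :* (:- con 0ℚ) := y :* con 0ℚ) refl (Cℚ (i ℕ.+ 0) i) (ι (+ (i ℕ.+ 0))) ⟩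
      ι (+ (i ℕ.+ 0)) * 0ℚ
        ≡⟨ cong (ι (+ (i ℕ.+ 0)) *_) (δ-≢ (ℕP.1+n≢n ∘ sym ∘ trans (sym (ℕP.+-identityʳ i)))) ⟨
      ι (+ (i ℕ.+ 0)) * δ (i ℕ.+ 0) (suc i)
        ∎
    onlyOne (suc zero) rewrite ℕP.+-comm i 1 = begin
      Cℚ (suc i) i * - 1ℚ * - 1ℚ
        ≡⟨ cong (λ x → x * - 1ℚ * - 1ℚ) (Cℚ-subdiagonal i) ⟩
      ι (+ suc i) * - 1ℚ * - 1ℚ
        ≡⟨ solve 1 (λ x → x :* (:- con 1ℚ) :* (:- con 1ℚ) := x :* con 1ℚ) refl (ι (+ suc i)) ⟩
      ι (+ suc i) * 1ℚ
        ≡⟨ cong (ι (+ suc i) *_) (δ-refl i) ⟨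
      ι (+ suc i) * δ i i
        ∎
    onlyOne (suc (suc n)) = begin
      Cℚ (i ℕ.+ m) i * signℚ m * - 0ℚ
        ≡⟨ solve 3 (λ x s y → x :* s :* (:- con 0ℚ) := y :* con 0ℚ) refl (Cℚ (i ℕ.+ m) i) (signℚ m) (ι (+ (i ℕ.+ m))) ⟩
      ι (+ (i ℕ.+ m)) * 0ℚ
        ≡⟨ cong (ι (+ (i ℕ.+ m)) *_) (δ-≢ (ℕP.m+1+n≢m i ∘ ℕP.suc-injective ∘ trans (sym (ℕP.+-suc i (suc n))))) ⟨
      ι (+ (i ℕ.+ m)) * δ (i ℕ.+ m) (suc i)
        ∎
      where m = suc (suc n)

∇-bernoulliReflected : ∀ K i → ∇ (suc K) (bernoulliReflected K) i ≡ ι (+ K) * δ K (suc i)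
∇-bernoulliReflected K i with i ℕ.≤? K
... | no  i≰K = ∇-bernoulliReflected-beyond (ℕP.≰⇒> i≰K)
... | yes i≤K with ℕP.m≤n⇒∃[o]m+o≡n i≤K
...   | n , refl = ∇-bernoulliReflected-within i n

antidiffPow : ℕ → ℕ → ℚ
antidiffPow k i = 1/[1+ k ] * bernoulliReflected (suc k) i

∇-antidiffPow : ∀ k i → ∇ (suc (suc k)) (antidiffPow k) i ≡ δ k i
∇-antidiffPow k i = begin
  ∇ (suc (suc k)) (antidiffPow k) i                 ≡⟨ ∇-*ˡ (suc (suc k)) 1/[1+ k ] (bernoulliReflected (suc k)) i ⟩
  1/[1+ k ] * ∇ (suc (suc k)) (bernoulliReflected (suc k)) i
                                                    ≡⟨ cong (1/[1+ k ] *_) (∇-bernoulliReflected (suc k) i) ⟩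
  1/[1+ k ] * (ι (+ suc k) * δ k i)                 ≡⟨ solve 3 (λ a b d → a :* (b :* d) := (b :* a) :* d) refl 1/[1+ k ] (ι (+ suc k)) (δ k i) ⟩
  ι (+ suc k) * 1/[1+ k ] * δ k i                   ≡⟨ cong (_* δ k i) (ι[1+n]*1/[1+n]≡1 k) ⟩
  1ℚ * δ k i                                        ≡⟨ ℚP.*-identityˡ (δ k i) ⟩
  δ k i                                             ∎
  where open ≡-Reasoning

antidiffPow-vanish : ∀ k j → suc (suc k) ≤ j → antidiffPow k j ≡ 0ℚ
antidiffPow-vanish k j k+2≤j = begin
  1/[1+ k ] * (xMinus1Pow (suc k) j * bernoulli (suc k ∸ j))
    ≡⟨ cong (λ x → 1/[1+ k ] * (x * bernoulli (suc k ∸ j))) (xMinus1Pow-vanish k+2≤j) ⟩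
  1/[1+ k ] * (0ℚ * bernoulli (suc k ∸ j))
    ≡⟨ solve 2 (λ a b → a :* (con 0ℚ :* b) := con 0ℚ) refl 1/[1+ k ] (bernoulli (suc k ∸ j)) ⟩
  0ℚ
    ∎
  where open ≡-Reasoning

-- Falling factorials

stirling1-vanish : ∀ {m k} → m < k → stirling1 m k ≡ + 0
stirling1-vanish {zero}  {suc k} _         = refl
stirling1-vanish {suc m} {suc k} (s≤s m<k)
  rewrite stirling1-vanish m<k | stirling1-vanish (ℕP.m<n⇒m<1+n m<k) | ℤP.*-zeroʳ (+ m) = refl

stirlingℚ : ℕ → ℕ → ℚ
stirlingℚ m i = ι (stirling1 m i)

stirlingℚ-vanish : ∀ {m k} → m < k → stirlingℚ m k ≡ 0ℚ
stirlingℚ-vanish m<k = cong ι (stirling1-vanish m<k)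

stirlingℚ-suc : ∀ m i → stirlingℚ (suc m) i ≡ mulX (stirlingℚ m) i - ι (+ m) * stirlingℚ m i
stirlingℚ-suc zero    zero    = refl
stirlingℚ-suc (suc m) zero    = sym (cong (λ x → 0ℚ - x) (ℚP.*-zeroʳ (ι (+ suc m))))
stirlingℚ-suc m       (suc i) = trans (ι-+ (stirling1 m i) (ℤ.- (+ m ℤ.* stirling1 m (suc i))))
  (cong (λ x → stirlingℚ m i + x) (trans (ι-neg (+ m ℤ.* stirling1 m (suc i))) (cong -_ (ι-* (+ m) (stirling1 m (suc i))))))

mul1+X-stirling-vanish : ∀ m j → suc (suc m) ≤ j → mul1+X (stirlingℚ m) j ≡ 0ℚ
mul1+X-stirling-vanish m (suc j) (s≤s m<j) =
  cong₂ _+_ (stirlingℚ-vanish (ℕP.m<n⇒m<1+n m<j)) (stirlingℚ-vanish m<j)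

-- (x − 1 + 1)·(x − 1)(x − 2)⋯(x − m) = x(x − 1)⋯(x − m)
shiftBack-mul1+X-stirling : ∀ m i → shiftBack (suc (suc m)) (mul1+X (stirlingℚ m)) i ≡ stirlingℚ (suc m) i
shiftBack-mul1+X-stirling zero zero          = refl
shiftBack-mul1+X-stirling zero (suc zero)    = refl
shiftBack-mul1+X-stirling zero (suc (suc i)) = sum-zero 2 (λ j → mul1+X (stirlingℚ 0) j * xMinus1Pow j (2 ℕ.+ i))
  (λ j j<2 → trans (cong (mul1+X (stirlingℚ 0) j *_) (xMinus1Pow-vanish (ℕP.≤-trans j<2 (ℕP.m≤m+n 2 i))))
                   (ℚP.*-zeroʳ (mul1+X (stirlingℚ 0) j)))
shiftBack-mul1+X-stirling (suc m) i = begin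
  shiftBack (suc b) (mul1+X (stirlingℚ (suc m))) i
    ≡⟨ shiftBack-cong (suc b) i (mul1+X-mulX-commute (ι (+ m)) (stirlingℚ m) (stirlingℚ (suc m)) (stirlingℚ-suc m)) ⟩
  shiftBack (suc b) (λ j → mulX u j - ι (+ m) * u j) i
    ≡⟨ shiftBack-- (suc b) (mulX u) (λ j → ι (+ m) * u j) i ⟩
  shiftBack (suc b) (mulX u) i - shiftBack (suc b) (λ j → ι (+ m) * u j) i
    ≡⟨ cong₂ _-_ (shiftBack-mulX b u i) (shiftBack-*ˡ (suc b) (ι (+ m)) u i) ⟩
  (mulX (shiftBack b u) i - shiftBack b u i) - ι (+ m) * shiftBack (suc b) u i
    ≡⟨ cong (λ x → (mulX (shiftBack b u) i - shiftBack b u i) - ι (+ m) * x)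
            (shiftBack-bound u i (ℕP.n≤1+n b) (mul1+X-stirling-vanish m)) ⟩
  (mulX (shiftBack b u) i - shiftBack b u i) - ι (+ m) * shiftBack b u i
    ≡⟨ cong₂ (λ x y → (x - y) - ι (+ m) * y) (mulX-cong (shiftBack-mul1+X-stirling m) i) (shiftBack-mul1+X-stirling m i) ⟩
  (mulX s i - s i) - ι (+ m) * s i
    ≡⟨ solve 3 (λ x y c → (x :- y) :- c :* y := x :- (con 1ℚ :+ c) :* y) refl (mulX s i) (s i) (ι (+ m)) ⟩
  mulX s i - (1ℚ + ι (+ m)) * s i
    ≡⟨ cong (λ c → mulX s i - c * s i) (ι-+ (+ 1) (+ m)) ⟨
  mulX s i - ι (+ suc m) * s i
    ≡⟨ stirlingℚ-suc (suc m) i ⟨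
  stirlingℚ (suc (suc m)) i
    ∎
  where
  open ≡-Reasoning
  b = suc (suc m)
  u = mul1+X (stirlingℚ m)
  s = stirlingℚ (suc m)

∇-mul1+X-stirling : ∀ m i → ∇ (suc (suc m)) (mul1+X (stirlingℚ m)) i ≡ ι (+ suc m) * stirlingℚ m i
∇-mul1+X-stirling m i = begin
  stirlingℚ m i + mulX (stirlingℚ m) i - shiftBack (suc (suc m)) (mul1+X (stirlingℚ m)) i
    ≡⟨ cong (λ x → stirlingℚ m i + mulX (stirlingℚ m) i - x) (trans (shiftBack-mul1+X-stirling m i) (stirlingℚ-suc m i)) ⟩
  stirlingℚ m i + mulX (stirlingℚ m) i - (mulX (stirlingℚ m) i - ι (+ m) * stirlingℚ m i)
    ≡⟨ solve 3 (λ x y c → x :+ y :- (y :- c :* x) := (con 1ℚ :+ c) :* x) refl (stirlingℚ m i) (mulX (stirlingℚ m) i) (ι (+ m)) ⟩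
  (1ℚ + ι (+ m)) * stirlingℚ m i
    ≡⟨ cong (_* stirlingℚ m i) (ι-+ (+ 1) (+ m)) ⟨
  ι (+ suc m) * stirlingℚ m i
    ∎
  where open ≡-Reasoning

antidiffFalling : ℕ → ℕ → ℚ
antidiffFalling m i = sumℚ (suc m) (λ k → stirlingℚ m k * antidiffPow k i)

∇-antidiffFalling : ∀ m i → ∇ (suc (suc m)) (antidiffFalling m) i ≡ stirlingℚ m i
∇-antidiffFalling m i = begin
  ∇ (suc (suc m)) (antidiffFalling m) i
    ≡⟨ ∇-sum-*ˡ (suc (suc m)) (suc m) (stirlingℚ m) antidiffPow i ⟩
  sumℚ (suc m) (λ k → stirlingℚ m k * ∇ (suc (suc m)) (antidiffPow k) i)
    ≡⟨ sum-cong (suc m) (λ k k<1+m → cong (stirlingℚ m k *_)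
         (trans (∇-bound (antidiffPow k) i (s≤s k<1+m) (antidiffPow-vanish k)) (∇-antidiffPow k i))) ⟩
  sumℚ (suc m) (λ k → stirlingℚ m k * δ k i)
    ≡⟨ sum-*δ (suc m) (stirlingℚ m) i (λ j → stirlingℚ-vanish) ⟩
  stirlingℚ m i
    ∎
  where open ≡-Reasoning

antidiffFalling-coefficient : ∀ m j → ι (+ suc m) * antidiffFalling m (suc j) ≡ mul1+X (stirlingℚ m) (suc j)
antidiffFalling-coefficient m j = x∙y⁻¹≈ε⇒x≈y _ _ (∇≡0⇒constant (suc m) d d-vanish ∇d≡0 j)
  where
  d : ℕ → ℚ
  d i = ι (+ suc m) * antidiffFalling m i - mul1+X (stirlingℚ m) i
  d-vanish : ∀ i → suc (suc m) ≤ i → d i ≡ 0ℚ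
  d-vanish i m+2≤i = begin
    ι (+ suc m) * antidiffFalling m i - mul1+X (stirlingℚ m) i
      ≡⟨ cong₂ (λ x y → ι (+ suc m) * x - y)
           (sum-zero (suc m) (λ k → stirlingℚ m k * antidiffPow k i) (λ k k<1+m →
             trans (cong (stirlingℚ m k *_) (antidiffPow-vanish k i (ℕP.≤-trans (s≤s k<1+m) m+2≤i)))
                   (ℚP.*-zeroʳ (stirlingℚ m k))))
           (mul1+X-stirling-vanish m i m+2≤i) ⟩
    ι (+ suc m) * 0ℚ - 0ℚ
      ≡⟨ solve 1 (λ c → c :* con 0ℚ :- con 0ℚ := con 0ℚ) refl (ι (+ suc m)) ⟩
    0ℚ
      ∎
    where open ≡-Reasoning
  ∇d≡0 : ∀ i → ∇ (suc (suc m)) d i ≡ 0ℚ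
  ∇d≡0 i = begin
    ∇ (suc (suc m)) d i
      ≡⟨ ∇-- (suc (suc m)) (λ i → ι (+ suc m) * antidiffFalling m i) (mul1+X (stirlingℚ m)) i ⟩
    ∇ (suc (suc m)) (λ i → ι (+ suc m) * antidiffFalling m i) i - ∇ (suc (suc m)) (mul1+X (stirlingℚ m)) i
      ≡⟨ cong₂ _-_ (trans (∇-*ˡ (suc (suc m)) (ι (+ suc m)) (antidiffFalling m) i) (cong (ι (+ suc m) *_) (∇-antidiffFalling m i)))
                   (∇-mul1+X-stirling m i) ⟩
    ι (+ suc m) * stirlingℚ m i - ι (+ suc m) * stirlingℚ m i
      ≡⟨ ℚP.+-inverseʳ (ι (+ suc m) * stirlingℚ m i) ⟩
    0ℚ
      ∎
    where open ≡-Reasoning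

antidiffFalling≡sum-term : ∀ m j → j ≤ m → antidiffFalling m (suc j) ≡ sumℚ (suc (m ∸ j)) (term m j)
antidiffFalling≡sum-term m j j≤m = begin
  sumℚ (suc m) f
    ≡⟨ cong (λ n → sumℚ n f) m+1≡j+[m-j+1] ⟩
  sumℚ (j ℕ.+ suc (m ∸ j)) f
    ≡⟨ sum-split j (suc (m ∸ j)) f ⟩
  sumℚ j f + sumℚ (suc (m ∸ j)) (λ d → f (j ℕ.+ d))
    ≡⟨ cong₂ _+_ (sum-zero j f below) (sum-cong (suc (m ∸ j)) (λ d _ → summand d)) ⟩
  0ℚ + sumℚ (suc (m ∸ j)) (term m j)
    ≡⟨ ℚP.+-identityˡ _ ⟩
  sumℚ (suc (m ∸ j)) (term m j)
    ∎
  where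
  open ≡-Reasoning
  f : ℕ → ℚ
  f k = stirlingℚ m k * antidiffPow k (suc j)
  m+1≡j+[m-j+1] : suc m ≡ j ℕ.+ suc (m ∸ j)
  m+1≡j+[m-j+1] = trans (cong suc (sym (ℕP.m+[n∸m]≡n j≤m))) (sym (ℕP.+-suc j (m ∸ j)))
  below : ∀ k → k < j → f k ≡ 0ℚ
  below k k<j = trans (cong (stirlingℚ m k *_) (antidiffPow-vanish k (suc j) (s≤s k<j))) (ℚP.*-zeroʳ (stirlingℚ m k))
  summand : ∀ d → f (j ℕ.+ d) ≡ term m j d
  summand d = begin
    stirlingℚ m k * (1/[1+ k ] * (Cℚ (suc k) (suc j) * signℚ (suc k ℕ.+ suc j) * bernoulli (k ∸ j)))
      ≡⟨ cong₂ (λ c σ → stirlingℚ m k * (1/[1+ k ] * (c * σ * bernoulli (k ∸ j)))) binomial sign ⟩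
    stirlingℚ m k * (1/[1+ k ] * (Cℚ (suc k) d * signℚ d * bernoulli (k ∸ j)))
      ≡⟨ cong (λ b → stirlingℚ m k * (1/[1+ k ] * (Cℚ (suc k) d * signℚ d * bernoulli b))) (ℕP.m+n∸m≡n j d) ⟩
    stirlingℚ m k * (1/[1+ k ] * (Cℚ (suc k) d * signℚ d * bernoulli d))
      ≡⟨ solve 5 (λ s r c σ b → s :* (r :* (c :* σ :* b)) := s :* r :* σ :* c :* b) refl
           (stirlingℚ m k) 1/[1+ k ] (Cℚ (suc k) d) (signℚ d) (bernoulli d) ⟩
    stirlingℚ m k * 1/[1+ k ] * signℚ d * Cℚ (suc k) d * bernoulli d
      ≡⟨ cong (λ x → x * signℚ d * Cℚ (suc k) d * bernoulli d) (/suc≡ι*1/[1+] (stirling1 m k) k) ⟨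
    term m j d
      ∎
    where
    k = j ℕ.+ d
    binomial : Cℚ (suc k) (suc j) ≡ Cℚ (suc k) d
    binomial = trans (Cℚ-symmetric (s≤s (ℕP.m≤m+n j d))) (cong (Cℚ (suc k)) (ℕP.m+n∸m≡n j d))
    sign : signℚ (suc k ℕ.+ suc j) ≡ signℚ d
    sign = trans (cong (-_ ∘ signℚ) (ℕP.+-suc k j)) (trans (⁻¹-involutive (signℚ (k ℕ.+ j))) (signℚ-conj j d))

lemma4p2 : (m j : ℕ) → j ≤ m →
    ((+ suc m) / 1) * sumℚ (suc (m ∸ j)) (term m j) ≡ (stirling1' m j / 1)
lemma4p2 m j j≤m = begin
  ι (+ suc m) * sumℚ (suc (m ∸ j)) (term m j)      ≡⟨ cong (ι (+ suc m) *_) (antidiffFalling≡sum-term m j j≤m) ⟨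
  ι (+ suc m) * antidiffFalling m (suc j)          ≡⟨ antidiffFalling-coefficient m j ⟩
  stirlingℚ m (suc j) + stirlingℚ m j              ≡⟨ ι-+ (stirling1 m (suc j)) (stirling1 m j) ⟨
  ι (stirling1' m j)                               ∎
  where open ≡-Reasoning
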